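{- Let $k$ be a positive integer, $H$ a graph, $v$ a vertex of $H$ with $d_H(v)<k$, and $H'=H-v$ with $\chi(H')\leq k$. Then $h_k(H)\leq h_k(H')+1$.
   Context: For a graph $H$ and $k\geq\chi(H)$, a proper $k$-coloring is a map $V(H)\to[k]$ giving adjacent vertices different colors. For a positive integer $j$, $G^j_k(H)$ has the proper $k$-colorings of $H$ as vertices, two distinct colorings adjacent if $H$ contains a connected subgraph on at most $j$ vertices containing all vertices where they differ; $h_k(H)$ is the least $j\geq1$ with $G^j_k(H)$ Hamiltonian (complete graphs are regarded as Hamiltonian). -}

module Defs where

open import Data.Nat using (ℕ; zero; suc; _≤_; _<_)
open import Data.Bool using (Bool; true; false)
open import Data.Fin using (Fin; punchIn)
open import Data.Fin.Subset using (Subset; ∣_∣) renaming (_∈_ to _∈ₛ_)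
open import Data.Vec using (Vec; lookup)
open import Data.List using (List; []; _∷_; _++_; [_]; length; filterᵇ; allFin)
open import Data.List.Membership.Propositional using () renaming (_∈_ to _∈ₗ_)
open import Data.List.Relation.Unary.All using (All)
open import Data.List.Relation.Unary.Unique.Propositional using (Unique)
open import Data.List.Relation.Unary.Linked using (Linked)
open import Data.Product using (Σ; ∃; _×_; _,_)
open import Data.Sum using (_⊎_)
open import Relation.Nullary using (¬_)
open import Relation.Binary.PropositionalEquality using (_≡_; _≢_)

record Graph (n : ℕ) : Set where
  field
    adj    : Fin n → Fin n → Bool
    sym    : ∀ x y → adj x y ≡ adj y x
    irrefl : ∀ x → adj x x ≡ false
open Graph public

degree : ∀ {n} → Graph n → Fin n → ℕ
degree G v = length (filterᵇ (adj G v) (allFin _))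

-- H - v : delete vertex v; vertices of H - v are Fin n, embedded via punchIn v
delete : ∀ {n} → Graph (suc n) → Fin (suc n) → Graph n
delete G v = record
  { adj    = λ x y → adj G (punchIn v x) (punchIn v y)
  ; sym    = λ x y → sym G (punchIn v x) (punchIn v y)
  ; irrefl = λ x → irrefl G (punchIn v x)
  }

Coloring : ℕ → ℕ → Set
Coloring k n = Vec (Fin k) n

Proper : ∀ {n k} → Graph n → Coloring k n → Set
Proper G c = ∀ x y → adj G x y ≡ true → lookup c x ≢ lookup c y

ChromaticAtMost : ∀ {n} → ℕ → Graph n → Set
ChromaticAtMost {n} k G = Σ (Coloring k n) (Proper G)

data WalkIn {n} (G : Graph n) (S : Subset n) : Fin n → Fin n → Set where
  here : ∀ {x} → x ∈ₛ S → WalkIn G S x x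
  step : ∀ {x y z} → x ∈ₛ S → adj G x y ≡ true → WalkIn G S y z → WalkIn G S x z

ConnectedIn : ∀ {n} → Graph n → Subset n → Set
ConnectedIn G S = ∀ x y → x ∈ₛ S → y ∈ₛ S → WalkIn G S x y

-- adjacency in G^j_k(H): distinct colorings, and some connected subgraph of H
-- on at most j vertices contains every vertex where they differ
ReconfAdj : ∀ {n k} → Graph n → ℕ → Coloring k n → Coloring k n → Set
ReconfAdj {n} G j c c' =
  c ≢ c' ×
  Σ (Subset n) λ S →
    ∣ S ∣ ≤ j × (∀ x → lookup c x ≢ lookup c' x → x ∈ₛ S) × ConnectedIn G S

-- Complete graphs count as Hamiltonian; otherwise a Hamiltonian cycle
-- (a cyclic ordering of all vertices, each exactly once, length ≥ 3).
Complete : {V : Set} → (V → Set) → (V → V → Set) → Set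
Complete {V} P E = ∀ (u w : V) → P u → P w → u ≢ w → E u w

HamCycle : {V : Set} → (V → Set) → (V → V → Set) → Set
HamCycle {V} P E =
  Σ V λ x → Σ (List V) λ xs →
    All P (x ∷ xs) × Unique (x ∷ xs) × (∀ u → P u → u ∈ₗ (x ∷ xs)) ×
    3 ≤ length (x ∷ xs) × Linked E (x ∷ xs ++ [ x ])

Hamiltonian : {V : Set} → (V → Set) → (V → V → Set) → Set
Hamiltonian P E = Complete P E ⊎ HamCycle P E

GHam : ∀ {n} → ℕ → ℕ → Graph n → Set
GHam {n} k j G = Hamiltonian {Coloring k n} (Proper G) (ReconfAdj G j)

IsHk : ∀ {n} → ℕ → Graph n → ℕ → Set
IsHk k G m = 1 ≤ m × GHam k m G × (∀ j → 1 ≤ j → j < m → ¬ GHam k j G)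

module Submission where

-- Let H' = H - v and m = h_k(H').  Proper colourings of H are the pairs (c , a)
-- of a proper colouring c of H' and a colour a unused by c on N(v); as
-- d_H(v) < k, each c has a nonempty list of such colours, its fibre.  An edge
-- c ~ d of G^m_k(H') with witness S is flexible if S meets N(v) (then S + v
-- witnesses (c , a) ~ (d , b) in G^(m+1)_k(H) for all a, b) and rigid otherwise
-- (then c, d have equal fibres and S witnesses (c , a) ~ (d , a)); pairs over
-- the same c are adjacent via {v}.  The abstract lemma FibreLifting.lift turns
-- a tour of a base graph with such fibres into a tour of the total graph
-- (snaking through the fibres, or in a prism pattern if every edge is rigid),
-- so G^(m+1)_k(H) is Hamiltonian.  Since Hamiltonicity of G^j_k(H) is decidable
-- by finite search, the least such j exists, and it is at most m + 1.

open import Defs hiding (sym)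
open import Data.Nat using (ℕ; zero; suc; _+_; _≤_; _<_; z≤n; s≤s; _≤?_)
open import Data.Nat.Properties using (≤-trans; ≤-reflexive; ≤-refl; ≤-pred; n≤1+n; m≤n+m; m≤n⇒m≤1+n; m≤n⇒m<n∨m≡n; +-suc; <⇒≱; ≤-<-trans; module ≤-Reasoning)
open import Data.Bool using (Bool; true; false; not; T; T?)
import Data.Bool.Properties as Bool
open import Data.Fin using (Fin; punchIn; punchOut; fromℕ<) renaming (zero to fzero; suc to fsuc)
open import Data.Fin.Properties using (any?; all?; punchIn-punchOut; ¬∀⟶∃¬) renaming (_≟_ to _≟ᶠ_)
open import Data.Fin.Subset using (Subset; ∣_∣; ⁅_⁆) renaming (_∈_ to _∈ₛ_)
open import Data.Fin.Subset.Properties using (x∈⁅x⁆; x∈⁅y⁆⇒x≡y; ∣⁅x⁆∣≡1) renaming (_∈?_ to _∈ₛ?_)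
open import Data.Vec using (Vec; []; _∷_; lookup; insertAt; removeAt)
import Data.Vec.Properties as Vec
open import Data.List using (List; []; _∷_; _++_; [_]; length; map; concatMap; filter; filterᵇ; allFin; deduplicate)
open import Data.List.Properties using (length-++; ++-assoc; ++-identityʳ; length-map; map-++; ∷-injective; length-tabulate; filter-≐)
open import Data.List.Membership.Propositional using (_∈_; _∉_)
open import Data.List.Membership.Propositional.Properties using (∈-∃++; ∈-++⁻; ∈-++⁺ʳ; ∈-++⁺ˡ; ∈-allFin; ∈-map⁺; ∈-map⁻; ∈-concat⁺′; ∈-filter⁺; ∈-filter⁻)
import Data.List.Membership.DecPropositional as DecMembership
open import Data.List.Relation.Unary.Any using (Any; here; there)
import Data.List.Relation.Unary.Any.Properties as Any
open import Data.List.Relation.Unary.All as All using (All; []; _∷_)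
import Data.List.Relation.Unary.All.Properties as All
open import Data.List.Relation.Unary.Unique.Propositional using (Unique; []; _∷_)
import Data.List.Relation.Unary.Unique.Propositional.Properties as Unique
import Data.List.Relation.Unary.AllPairs as AllPairs
import Data.List.Relation.Unary.Unique.DecPropositional as DecUnique
import Data.List.Relation.Unary.Unique.DecPropositional.Properties as DecUnique
open import Data.List.Relation.Unary.Linked as Linked using (Linked; []; [-]; _∷_; linked?)
import Data.List.Relation.Unary.Linked.Properties as Linked
open import Data.Product using (Σ; ∃; _×_; _,_; proj₁; proj₂)
open import Data.Product.Properties using (,-injectiveʳ)
open import Data.Sum using (_⊎_; inj₁; inj₂)
open import Data.Empty using (⊥-elim)
open import Data.Unit using (tt)
open import Relation.Nullary using (¬_; Dec; yes; no; ¬?)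
open import Relation.Nullary.Decidable using (_×-dec_; _→-dec_; _⊎-dec_; decidable-stable; map′)
open import Relation.Unary using (Decidable)
open import Relation.Binary.PropositionalEquality using (_≡_; _≢_; refl; sym; trans; cong; cong₂; subst; module ≡-Reasoning)

private
  variable
    A V W : Set

lastOf : A → List A → A
lastOf x []       = x
lastOf _ (y ∷ ys) = lastOf y ys

lastOf-snoc : (x : A) (xs : List A) (y : A) → lastOf x (xs ++ [ y ]) ≡ y
lastOf-snoc x []       y = refl
lastOf-snoc x (z ∷ zs) y = lastOf-snoc z zs y

lastOf-map : (f : A → W) (x : A) (xs : List A) → lastOf (f x) (map f xs) ≡ f (lastOf x xs)
lastOf-map f x []       = refl
lastOf-map f x (y ∷ ys) = lastOf-map f y ys

lastOf-∈ : (x : A) (xs : List A) → lastOf x xs ∈ x ∷ xs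
lastOf-∈ x []       = here refl
lastOf-∈ x (y ∷ ys) = there (lastOf-∈ y ys)

module _ {R : A → A → Set} where

  linked-++ : ∀ x xs y ys → Linked R (x ∷ xs) → R (lastOf x xs) y → Linked R (y ∷ ys) →
              Linked R (x ∷ xs ++ y ∷ ys)
  linked-++ x []       y ys [-]      r q = r ∷ q
  linked-++ x (z ∷ zs) y ys (e ∷ p)  r q = e ∷ linked-++ z zs y ys p r q

  linked-unsnoc : ∀ x xs y → Linked R (x ∷ xs ++ [ y ]) → Linked R (x ∷ xs) × R (lastOf x xs) y
  linked-unsnoc x []       y (r ∷ [-]) = [-] , r
  linked-unsnoc x (z ∷ zs) y (e ∷ p) with linked-unsnoc z zs y p
  ... | q , r = e ∷ q , r

unique-length-≤ : (xs ys : List A) → Unique xs → (∀ {a} → a ∈ xs → a ∈ ys) → length xs ≤ length ys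
unique-length-≤ []       ys _          _   = z≤n
unique-length-≤ (x ∷ xs) ys (x∉ ∷ uxs) sub with ∈-∃++ (sub (here refl))
... | ys₁ , ys₂ , refl =
  ≤-trans (s≤s (unique-length-≤ xs (ys₁ ++ ys₂) uxs sub′)) (≤-reflexive length-split)
  where
  sub′ : ∀ {a} → a ∈ xs → a ∈ ys₁ ++ ys₂
  sub′ {a} a∈ with ∈-++⁻ ys₁ (sub (there a∈))
  ... | inj₁ p         = ∈-++⁺ˡ p
  ... | inj₂ (here refl) = ⊥-elim (All.lookup x∉ a∈ refl)
  ... | inj₂ (there p) = ∈-++⁺ʳ ys₁ p
  length-split : suc (length (ys₁ ++ ys₂)) ≡ length (ys₁ ++ x ∷ ys₂)
  length-split = begin
    suc (length (ys₁ ++ ys₂))          ≡⟨ cong suc (length-++ ys₁) ⟩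
    suc (length ys₁ + length ys₂) ≡⟨ sym (+-suc (length ys₁) (length ys₂)) ⟩
    length ys₁ + length (x ∷ ys₂) ≡⟨ sym (length-++ ys₁) ⟩
    length (ys₁ ++ x ∷ ys₂)            ∎
    where open ≡-Reasoning

reverse⁺ : A → List A → A × List A
reverse⁺ h []       = h , []
reverse⁺ h (x ∷ xs) = proj₁ (reverse⁺ x xs) , proj₂ (reverse⁺ x xs) ++ [ h ]

reverse⁺-head : (h : A) (t : List A) → proj₁ (reverse⁺ h t) ≡ lastOf h t
reverse⁺-head h []       = refl
reverse⁺-head h (x ∷ xs) = reverse⁺-head x xs

reverse⁺-last : (h : A) (t : List A) → lastOf (proj₁ (reverse⁺ h t)) (proj₂ (reverse⁺ h t)) ≡ h
reverse⁺-last h []       = refl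
reverse⁺-last h (x ∷ xs) = lastOf-snoc (proj₁ (reverse⁺ x xs)) (proj₂ (reverse⁺ x xs)) h

cons : A × List A → List A
cons (x , xs) = x ∷ xs

reverse⁺-∈⁺ : (h : A) (t : List A) {a : A} → a ∈ h ∷ t → a ∈ cons (reverse⁺ h t)
reverse⁺-∈⁺ h []       p           = p
reverse⁺-∈⁺ h (x ∷ xs) (here refl) = there (∈-++⁺ʳ (proj₂ (reverse⁺ x xs)) (here refl))
reverse⁺-∈⁺ h (x ∷ xs) (there p) with reverse⁺-∈⁺ x xs p
... | here e  = here e
... | there q = there (∈-++⁺ˡ q)

reverse⁺-∈⁻ : (h : A) (t : List A) {a : A} → a ∈ cons (reverse⁺ h t) → a ∈ h ∷ t
reverse⁺-∈⁻ h []       p         = p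
reverse⁺-∈⁻ h (x ∷ xs) (here e)  = there (reverse⁺-∈⁻ x xs (here e))
reverse⁺-∈⁻ h (x ∷ xs) (there q) with ∈-++⁻ (proj₂ (reverse⁺ x xs)) q
... | inj₁ r         = there (reverse⁺-∈⁻ x xs (there r))
... | inj₂ (here e)  = here e

reverse⁺-unique : (h : A) (t : List A) → Unique (h ∷ t) → Unique (cons (reverse⁺ h t))
reverse⁺-unique h []       u          = u
reverse⁺-unique h (x ∷ xs) (h∉ ∷ u) =
  Unique.++⁺ (reverse⁺-unique x xs u) ([] ∷ [])
    (λ { (p , here refl) → All.lookup h∉ (reverse⁺-∈⁻ x xs p) refl })

-- Unlike a Hamiltonian cycle it may have
-- just two vertices (an edge traversed back and forth), so that every complete
-- graph on at least two vertices has one.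
record Tour {V : Set} (P : V → Set) (E : V → V → Set) : Set where
  constructor tour
  field
    start  : V
    rest   : List V
    inside : All P (start ∷ rest)
    unique : Unique (start ∷ rest)
    covers : ∀ u → P u → u ∈ start ∷ rest
    long   : 2 ≤ length (start ∷ rest)
    closed : Linked E (start ∷ rest ++ [ start ])

module _ {P : V → Set} {E : V → V → Set} where

  hamCycle⇒tour : HamCycle P E → Tour P E
  hamCycle⇒tour (x , xs , ins , u , cov , len , lk) = tour x xs ins u cov (≤-trans (n≤1+n 2) len) lk

  tour⇒hamiltonian : Tour P E → Hamiltonian P E
  tour⇒hamiltonian (tour y []           _   _ _   (s≤s ()) _)
  tour⇒hamiltonian (tour y (z ∷ [])     _   _ cov _        (e₁ ∷ e₂ ∷ [-])) = inj₁ complete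
    where
    complete : Complete P E
    complete a b pa pb a≢b with cov a pa | cov b pb
    ... | here refl         | here refl         = ⊥-elim (a≢b refl)
    ... | here refl         | there (here refl) = e₁
    ... | there (here refl) | here refl         = e₂
    ... | there (here refl) | there (here refl) = ⊥-elim (a≢b refl)
  tour⇒hamiltonian (tour y (z ∷ w ∷ ws) ins u cov _        lk) =
    inj₂ (y , z ∷ w ∷ ws , ins , u , cov , s≤s (s≤s (s≤s z≤n)) , lk)

  complete⇒tour : Complete P E → ∀ x y ys → All P (x ∷ y ∷ ys) → Unique (x ∷ y ∷ ys) →
                  (∀ u → P u → u ∈ x ∷ y ∷ ys) → Tour P E
  complete⇒tour cmp x y ys ins@(px ∷ ps) u@(x∉ ∷ u′) cov =
    tour x (y ∷ ys) ins u cov (s≤s (s≤s z≤n))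
      (cmp x y px (All.head ps) (All.head x∉) ∷ path y ys ps u′ (λ p → All.lookup x∉ p refl))
    where
    path : ∀ z zs → All P (z ∷ zs) → Unique (z ∷ zs) → x ∉ z ∷ zs → Linked E (z ∷ zs ++ [ x ])
    path z []        (pz ∷ [])     _               x∉′ = cmp z x pz px (λ e → x∉′ (here (sym e))) ∷ [-]
    path z (z′ ∷ zs) (pz ∷ ps′) ((z≢z′ ∷ _) ∷ u″) x∉′ =
      cmp z z′ pz (All.head ps′) z≢z′ ∷ path z′ zs ps′ u″ (λ p → x∉′ (there p))

tour-map : {P : V → Set} {E : V → V → Set} {Q : W → Set} {F : W → W → Set} (f : V → W) →
           (∀ {x y} → f x ≡ f y → x ≡ y) → (∀ {x} → P x → Q (f x)) →
           (∀ w → Q w → ∃ λ x → P x × w ≡ f x) → (∀ {x y} → E x y → F (f x) (f y)) →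
           Tour P E → Tour Q F
tour-map {Q = Q} {F = F} f f-inj f-P f-onto f-E (tour x xs ins u cov len lk) =
  tour (f x) (map f xs) (All.map⁺ (All.map f-P ins)) (Unique.map⁺ f-inj u) cov′
    (subst (2 ≤_) (sym (length-map f (x ∷ xs))) len)
    (subst (Linked F) (map-++ f (x ∷ xs) [ x ]) (Linked.map⁺ (Linked.map f-E lk)))
  where
  cov′ : ∀ w → Q w → w ∈ f x ∷ map f xs
  cov′ w qw with f-onto w qw
  ... | y , py , refl = ∈-map⁺ f (cov y py)

Searchable : Set → Set₁
Searchable A = ∀ {P : A → Set} → Decidable P → Dec (∃ P)

search-Bool : Searchable Bool
search-Bool P? with P? true | P? false
... | yes p | _     = yes (true , p)
... | no _  | yes p = yes (false , p)
... | no ¬t | no ¬f = no λ { (true , p) → ¬t p ; (false , p) → ¬f p }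

search-Vec : Searchable A → ∀ n → Searchable (Vec A n)
search-Vec sA zero    P? = map′ (λ p → [] , p) (λ { ([] , p) → p }) (P? [])
search-Vec sA (suc n) P? =
  map′ (λ { (a , w , p) → a ∷ w , p }) (λ { (a ∷ w , p) → a , w , p })
       (sA (λ a → search-Vec sA n (λ w → P? (a ∷ w))))

search-Coloring : ∀ k n → Searchable (Coloring k n)
search-Coloring k n = search-Vec any? n

decide-∀ : Searchable A → ∀ {P : A → Set} → Decidable P → Dec (∀ a → P a)
decide-∀ sA P? with sA (λ a → ¬? (P? a))
... | yes (a , ¬pa) = no (λ all → ¬pa (all a))
... | no ¬ex        = yes (λ a → decidable-stable (P? a) (λ ¬pa → ¬ex (a , ¬pa)))

search-List : Searchable A → ∀ N {P : List A → Set} → Decidable P →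
              Dec (∃ λ xs → length xs ≤ N × P xs)
search-List sA N P? with P? []
... | yes p = yes ([] , z≤n , p)
search-List sA zero P? | no ¬p = no λ { ([] , _ , p) → ¬p p ; (_ ∷ _ , () , _) }
search-List sA (suc N) P? | no ¬p with sA (λ a → search-List sA N (λ xs → P? (a ∷ xs)))
... | yes (a , xs , len , p) = yes (a ∷ xs , s≤s len , p)
... | no ¬ex = no λ { ([] , _ , p) → ¬p p ; (a ∷ xs , s≤s len , p) → ¬ex (a , xs , len , p) }

colorings : ∀ k n → List (Coloring k n)
colorings k zero    = [ [] ]
colorings k (suc n) = concatMap (λ a → map (a ∷_) (colorings k n)) (allFin k)

∈-colorings : ∀ {k n} (c : Coloring k n) → c ∈ colorings k n
∈-colorings []      = here refl
∈-colorings {k} (a ∷ c) =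
  ∈-concat⁺′ (∈-map⁺ (a ∷_) (∈-colorings c)) (∈-map⁺ (λ b → map (b ∷_) (colorings k _)) (∈-allFin a))

-- Connectivity of G[S] is decidable: a walk can be shortcut to one without
-- repeated vertices, hence of length < n, and walks of bounded length are
-- found by search.
module Walks {n} (G : Graph n) (S : Subset n) where

  vertices : ∀ {x y} → WalkIn G S x y → List (Fin n)
  vertices {x} (here _)     = [ x ]
  vertices {x} (step _ _ w) = x ∷ vertices w

  steps : ∀ {x y} → WalkIn G S x y → ℕ
  steps (here _)     = 0
  steps (step _ _ w) = suc (steps w)

  length-vertices : ∀ {x y} (w : WalkIn G S x y) → length (vertices w) ≡ suc (steps w)
  length-vertices (here _)     = refl
  length-vertices (step _ _ w) = cong suc (length-vertices w)

  suffix : ∀ {x y z} (w : WalkIn G S y z) → x ∈ vertices w →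
           Σ (WalkIn G S x z) λ w′ → Unique (vertices w) → Unique (vertices w′)
  suffix (here p)     (here refl) = here p , λ u → u
  suffix (step p a w) (here refl) = step p a w , λ u → u
  suffix (step p a w) (there q) with suffix w q
  ... | w′ , keep = w′ , λ { (_ ∷ u) → keep u }

  shortcut : ∀ {x y} → WalkIn G S x y → Σ (WalkIn G S x y) λ w′ → Unique (vertices w′)
  shortcut (here p) = here p , [] ∷ []
  shortcut {x} (step p a w) with shortcut w
  ... | w′ , u with DecMembership._∈?_ _≟ᶠ_ x (vertices w′)
  ...   | yes x∈ = proj₁ (suffix w′ x∈) , proj₂ (suffix w′ x∈) u
  ...   | no x∉  = step p a w′ , All.¬Any⇒All¬ _ x∉ ∷ u

  steps-unique : ∀ {x y} (w : WalkIn G S x y) → Unique (vertices w) → steps w ≤ n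
  steps-unique w u = ≤-trans (n≤1+n (steps w))
    (subst (_≤ n) (length-vertices w)
      (≤-trans (unique-length-≤ (vertices w) (allFin n) u (λ _ → ∈-allFin _)) (≤-reflexive (length-tabulate _))))

  ShortWalk : ℕ → Fin n → Fin n → Set
  ShortWalk zero    x y = x ∈ₛ S × x ≡ y
  ShortWalk (suc t) x y = x ∈ₛ S × (x ≡ y ⊎ ∃ λ z → adj G x z ≡ true × ShortWalk t z y)

  shortWalk? : ∀ t x y → Dec (ShortWalk t x y)
  shortWalk? zero    x y = (x ∈ₛ? S) ×-dec (x ≟ᶠ y)
  shortWalk? (suc t) x y =
    (x ∈ₛ? S) ×-dec ((x ≟ᶠ y) ⊎-dec any? (λ z → (adj G x z Bool.≟ true) ×-dec shortWalk? t z y))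

  shortWalk⇒walk : ∀ t x y → ShortWalk t x y → WalkIn G S x y
  shortWalk⇒walk zero    x y (p , refl)              = here p
  shortWalk⇒walk (suc t) x y (p , inj₁ refl)         = here p
  shortWalk⇒walk (suc t) x y (p , inj₂ (z , a , sw)) = step p a (shortWalk⇒walk t z y sw)

  walk⇒shortWalk : ∀ t {x y} (w : WalkIn G S x y) → steps w ≤ t → ShortWalk t x y
  walk⇒shortWalk zero    (here p)     _       = p , refl
  walk⇒shortWalk (suc t) (here p)     _       = p , inj₁ refl
  walk⇒shortWalk (suc t) (step p a w) (s≤s ≤t) = p , inj₂ (_ , a , walk⇒shortWalk t w ≤t)

  walk? : ∀ x y → Dec (WalkIn G S x y)
  walk? x y = map′ (shortWalk⇒walk n x y) short (shortWalk? n x y)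
    where
    short : WalkIn G S x y → ShortWalk n x y
    short w with shortcut w
    ... | w′ , u = walk⇒shortWalk n w′ (steps-unique w′ u)

_≟ᶜ_ : ∀ {k n} (c d : Coloring k n) → Dec (c ≡ d)
_≟ᶜ_ = Vec.≡-dec _≟ᶠ_

listing : ∀ {k n} {P : Coloring k n → Set} → Decidable P →
          Σ (List (Coloring k n)) λ cs → All P cs × Unique cs × (∀ c → P c → c ∈ cs)
listing {k} {n} P? =
  cs , All.tabulate (λ c∈ → proj₂ (∈-filter⁻ P? {xs = colorings k n} (Any.deduplicate⁻ _≟ᶜ_ c∈))) ,
  DecUnique.deduplicate-! _≟ᶜ_ _ ,
  λ c pc → Any.deduplicate⁺ _≟ᶜ_ (λ e p → trans p (sym e)) (∈-filter⁺ P? (∈-colorings c) pc)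
  where
  cs : List (Coloring k n)
  cs = deduplicate _≟ᶜ_ (filter P? (colorings k n))

proper? : ∀ {n k} (G : Graph n) (c : Coloring k n) → Dec (Proper G c)
proper? G c = all? λ x → all? λ y → (adj G x y Bool.≟ true) →-dec ¬? (lookup c x ≟ᶠ lookup c y)

connected? : ∀ {n} (G : Graph n) (S : Subset n) → Dec (ConnectedIn G S)
connected? G S = all? λ x → all? λ y → (x ∈ₛ? S) →-dec ((y ∈ₛ? S) →-dec Walks.walk? G S x y)

reconfAdj? : ∀ {n k} (G : Graph n) j (c d : Coloring k n) → Dec (ReconfAdj G j c d)
reconfAdj? {n} G j c d = ¬? (c ≟ᶜ d) ×-dec search-Vec search-Bool n λ S →
  (∣ S ∣ ≤? j) ×-dec all? (λ x → ¬? (lookup c x ≟ᶠ lookup d x) →-dec (x ∈ₛ? S)) ×-dec connected? G S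

-- Hamiltonicity of G^j_k(G) is decidable: a Hamiltonian cycle has no more
-- entries than there are colourings, so it is found by bounded search.
gHam? : ∀ {n} k j (G : Graph n) → Dec (GHam k j G)
gHam? {n} k j G = complete? ⊎-dec hamCycle?
  where
  search : Searchable (Coloring k n)
  search = search-Coloring k n

  P? : Decidable (Proper G)
  P? = proper? G

  E? : ∀ c d → Dec (ReconfAdj G j c d)
  E? = reconfAdj? G j

  complete? : Dec (Complete (Proper G) (ReconfAdj G j))
  complete? = decide-∀ search λ u → decide-∀ search λ w →
    P? u →-dec (P? w →-dec (¬? (u ≟ᶜ w) →-dec E? u w))

  Cycle : Coloring k n → List (Coloring k n) → Set
  Cycle x xs = All (Proper G) (x ∷ xs) × Unique (x ∷ xs) × (∀ u → Proper G u → u ∈ x ∷ xs) ×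
    3 ≤ length (x ∷ xs) × Linked (ReconfAdj G j) (x ∷ xs ++ [ x ])

  cycle? : ∀ x xs → Dec (Cycle x xs)
  cycle? x xs = All.all? P? (x ∷ xs) ×-dec DecUnique.unique? _≟ᶜ_ (x ∷ xs) ×-dec
    decide-∀ search (λ u → P? u →-dec DecMembership._∈?_ _≟ᶜ_ u (x ∷ xs)) ×-dec
    (3 ≤? length (x ∷ xs)) ×-dec linked? E? (x ∷ xs ++ [ x ])

  bound : ∀ x xs → Cycle x xs → length xs ≤ length (colorings k n)
  bound x xs (_ , u , _) = ≤-trans (n≤1+n _) (unique-length-≤ (x ∷ xs) _ u (λ {c} _ → ∈-colorings c))

  hamCycle? : Dec (HamCycle (Proper G) (ReconfAdj G j))
  hamCycle? = search λ x → map′ (λ { (xs , _ , cyc) → xs , cyc }) (λ { (xs , cyc) → xs , bound x xs cyc , cyc })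
    (search-List search (length (colorings k n)) (cycle? x))

IsLeast : (ℕ → Set) → ℕ → Set
IsLeast Q m = 1 ≤ m × Q m × (∀ j → 1 ≤ j → j < m → ¬ Q j)

module _ {Q : ℕ → Set} (Q? : ∀ j → Dec (Q j)) where

  least-upTo : ∀ M → (∃ λ m → IsLeast Q m × m ≤ M) ⊎ (∀ j → 1 ≤ j → j ≤ M → ¬ Q j)
  least-upTo zero = inj₂ λ { j () z≤n }
  least-upTo (suc M) with least-upTo M
  ... | inj₁ (m , least , m≤M) = inj₁ (m , least , m≤n⇒m≤1+n m≤M)
  ... | inj₂ none with Q? (suc M)
  ...   | yes q = inj₁ (suc M , (s≤s z≤n , q , λ j 1≤j j<1+M → none j 1≤j (≤-pred j<1+M)) , ≤-refl)
  ...   | no ¬q = inj₂ λ j 1≤j j≤1+M → below-or-at j 1≤j (m≤n⇒m<n∨m≡n j≤1+M)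
    where
    below-or-at : ∀ j → 1 ≤ j → j < suc M ⊎ j ≡ suc M → ¬ Q j
    below-or-at j 1≤j (inj₁ j<1+M) = none j 1≤j (≤-pred j<1+M)
    below-or-at j 1≤j (inj₂ refl)  = ¬q

  least-≤ : ∀ M → Q (suc M) → ∃ λ m → IsLeast Q m × m ≤ suc M
  least-≤ M q with least-upTo (suc M)
  ... | inj₁ found = found
  ... | inj₂ none  = ⊥-elim (none (suc M) (s≤s z≤n) ≤-refl q)

module FibreLifting
  {B C : Set} (Pb : B → Set) (Eb : B → B → Set)
  (hd : B → C) (tl : B → List C) (fibre-unique : ∀ c → Unique (hd c ∷ tl c))
  (E : B × C → B × C → Set) (E-sym : ∀ {p q} → E p q → E q p)
  (vertical : ∀ c a b → a ≢ b → E (c , a) (c , b))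
  (classify : ∀ {c d} → Eb c d →
     (hd c ≡ hd d × tl c ≡ tl d × (∀ a → E (c , a) (d , a))) ⊎ (∀ a b → E (c , a) (d , b)))
  where

  fibre : B → List C
  fibre c = hd c ∷ tl c

  Total : B × C → Set
  Total (c , a) = Pb c × a ∈ fibre c

  Rigid : B → B → Set
  Rigid c d = hd c ≡ hd d × tl c ≡ tl d × (∀ a → E (c , a) (d , a))

  Flexible : B → B → Set
  Flexible c d = ∀ a b → E (c , a) (d , b)

  -- A block: a nonempty run of colours, all over the same base vertex.  The
  -- lifted tour is the concatenation of a chain of blocks.
  record Block : Set where
    constructor block
    field
      base  : B
      first : C
      rest  : List C
  open Block

  colours : Block → List C
  colours b = first b ∷ rest b

  lastColour : Block → C
  lastColour b = lastOf (first b) (rest b)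

  pairs : Block → List (B × C)
  pairs b = map (base b ,_) (colours b)

  flatten : List Block → List (B × C)
  flatten []       = []
  flatten (b ∷ bs) = pairs b ++ flatten bs

  Joined : Block → Block → Set
  Joined b b′ = E (base b , lastColour b) (base b′ , first b′)

  home : Block → Block
  home b = block (base b) (first b) []

  UniqueBlock : Block → Set
  UniqueBlock b = Unique (colours b)

  BlockInside : Block → Set
  BlockInside b = Pb (base b) × (∀ {a} → a ∈ colours b → a ∈ fibre (base b))

  flatten-++ : ∀ bs bs′ → flatten (bs ++ bs′) ≡ flatten bs ++ flatten bs′
  flatten-++ []       bs′ = refl
  flatten-++ (b ∷ bs) bs′ = trans (cong (pairs b ++_) (flatten-++ bs bs′)) (sym (++-assoc (pairs b) (flatten bs) (flatten bs′)))

  pairs-linked : ∀ b → UniqueBlock b → Linked E (pairs b)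
  pairs-linked b u = Linked.map⁺ (Linked.map (vertical (base b) _ _) (Linked.AllPairs⇒Linked u))

  flatten-linked : ∀ b bs → All UniqueBlock (b ∷ bs) → Linked Joined (b ∷ bs) → Linked E (flatten (b ∷ bs))
  flatten-linked b []        (u ∷ [])  [-]     = subst (Linked E) (sym (++-identityʳ (pairs b))) (pairs-linked b u)
  flatten-linked b (b′ ∷ bs) (u ∷ us) (j ∷ js) =
    linked-++ (base b , first b) (map (base b ,_) (rest b)) (base b′ , first b′) (map (base b′ ,_) (rest b′) ++ flatten bs)
      (pairs-linked b u) (subst (λ p → E p (base b′ , first b′)) (sym (lastOf-map (base b ,_) (first b) (rest b))) j)
      (flatten-linked b′ bs us js)

  ∈-flatten⁻ : ∀ bs {q} → q ∈ flatten bs → Any (λ b → base b ≡ proj₁ q × proj₂ q ∈ colours b) bs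
  ∈-flatten⁻ (b ∷ bs) p with ∈-++⁻ (pairs b) p
  ... | inj₂ p′ = there (∈-flatten⁻ bs p′)
  ... | inj₁ p′ with ∈-map⁻ (base b ,_) p′
  ...   | a , a∈ , refl = here (refl , a∈)

  ∈-flatten⁺ : ∀ bs {b a} → b ∈ bs → a ∈ colours b → (base b , a) ∈ flatten bs
  ∈-flatten⁺ (b ∷ bs) (here refl) a∈ = ∈-++⁺ˡ (∈-map⁺ (base b ,_) a∈)
  ∈-flatten⁺ (b ∷ bs) (there b∈)  a∈ = ∈-++⁺ʳ (pairs b) (∈-flatten⁺ bs b∈ a∈)

  flatten-inside : ∀ bs → All BlockInside bs → ∀ {q} → q ∈ flatten bs → Total q
  flatten-inside bs ins {q} q∈ with All.lookupAny ins (∈-flatten⁻ bs q∈)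
  ... | (pc , sub) , e , a∈ = subst Pb e pc , subst (λ c → proj₂ q ∈ fibre c) e (sub a∈)

  flatten-bases : ∀ {L} bs → All (λ b → base b ∈ L) bs → ∀ {q} → q ∈ flatten bs → proj₁ q ∈ L
  flatten-bases {L} bs bases q∈ with All.lookupAny bases (∈-flatten⁻ bs q∈)
  ... | c∈ , e , _ = subst (_∈ L) e c∈

  bases-∈ : ∀ bs → All (λ b → base b ∈ map base bs) bs
  bases-∈ bs = All.tabulate (∈-map⁺ base)

  flatten-unique : ∀ bs → Unique (map base bs) → All UniqueBlock bs → Unique (flatten bs)
  flatten-unique []       _          _        = []
  flatten-unique (b ∷ bs) (b∉ ∷ ubs) (u ∷ us) =
    Unique.++⁺ (Unique.map⁺ ,-injectiveʳ u) (flatten-unique bs ubs us) λ (p , q) →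
      All.lookup b∉ (subst (_∈ map base bs) (pair-base p) (flatten-bases bs (bases-∈ bs) q)) refl
    where
    pair-base : ∀ {q} → q ∈ pairs b → proj₁ q ≡ base b
    pair-base q∈ with ∈-map⁻ (base b ,_) q∈
    ... | _ , _ , refl = refl

  length-flatten : ∀ bs → length bs ≤ length (flatten bs)
  length-flatten []       = z≤n
  length-flatten (b ∷ bs) = s≤s (≤-trans (length-flatten bs)
    (≤-trans (m≤n+m (length (flatten bs)) (length (map (base b ,_) (rest b))))
             (≤-reflexive (sym (length-++ (map (base b ,_) (rest b)))))))

  chain⇒tour : ∀ b₀ bs → Linked Joined (b₀ ∷ bs ++ [ home b₀ ]) → All UniqueBlock (b₀ ∷ bs) →
               All BlockInside (b₀ ∷ bs) → Unique (flatten (b₀ ∷ bs)) →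
               (∀ c a → Pb c → a ∈ fibre c → (c , a) ∈ flatten (b₀ ∷ bs)) → 2 ≤ length (b₀ ∷ bs) →
               Tour Total E
  chain⇒tour b₀ bs joined us ins u cov len =
    tour (base b₀ , first b₀) (map (base b₀ ,_) (rest b₀) ++ flatten bs)
      (All.tabulate (flatten-inside (b₀ ∷ bs) ins)) u (λ { (c , a) (pc , a∈) → cov c a pc a∈ })
      (≤-trans len (length-flatten (b₀ ∷ bs)))
      (subst (Linked E) closing (flatten-linked b₀ (bs ++ [ home b₀ ]) (All.++⁺ us (([] ∷ []) ∷ [])) joined))
    where
    closing : flatten (b₀ ∷ bs ++ [ home b₀ ]) ≡ (pairs b₀ ++ flatten bs) ++ [ (base b₀ , first b₀) ]
    closing = trans (cong (pairs b₀ ++_) (flatten-++ bs [ home b₀ ])) (sym (++-assoc (pairs b₀) (flatten bs) _))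

  -- Snake tours: walk along the base tour, traversing each fibre as one block;
  -- across a rigid edge the next fibre is traversed in reverse, so that the
  -- junction is an edge (c , a) ~ (d , a).

  readAs : Bool → B → C × List C
  readAs false c = hd c , tl c
  readAs true  c = reverse⁺ (hd c) (tl c)

  oriented : Bool → B → Block
  oriented o c = block c (proj₁ (readAs o c)) (proj₂ (readAs o c))

  oriented-unique : ∀ o c → UniqueBlock (oriented o c)
  oriented-unique false c = fibre-unique c
  oriented-unique true  c = reverse⁺-unique (hd c) (tl c) (fibre-unique c)

  oriented-∈⁻ : ∀ o c {a} → a ∈ colours (oriented o c) → a ∈ fibre c
  oriented-∈⁻ false c p = p
  oriented-∈⁻ true  c p = reverse⁺-∈⁻ (hd c) (tl c) p

  oriented-∈⁺ : ∀ o c {a} → a ∈ fibre c → a ∈ colours (oriented o c)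
  oriented-∈⁺ false c p = p
  oriented-∈⁺ true  c p = reverse⁺-∈⁺ (hd c) (tl c) p

  E-resp : ∀ {c d a a′ b b′} → a ≡ a′ → b ≡ b′ → E (c , a) (d , b) → E (c , a′) (d , b′)
  E-resp refl refl e = e

  rigid-joined : ∀ o c d → Rigid c d → Joined (oriented o c) (oriented (not o) d)
  rigid-joined false c d (hd≡ , tl≡ , same) =
    E-resp refl (trans (cong₂ lastOf hd≡ tl≡) (sym (reverse⁺-head (hd d) (tl d)))) (same (lastOf (hd c) (tl c)))
  rigid-joined true  c d (hd≡ , tl≡ , same) =
    E-resp (sym (reverse⁺-last (hd c) (tl c))) hd≡ (same (hd c))

  next : ∀ {c d} → Bool → Rigid c d ⊎ Flexible c d → Bool
  next o (inj₁ _) = not o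
  next o (inj₂ _) = false

  next-joined : ∀ o c d (e : Eb c d) → Joined (oriented o c) (oriented (next o (classify e)) d)
  next-joined o c d e with classify e
  ... | inj₁ rigid    = rigid-joined o c d rigid
  ... | inj₂ flexible = flexible _ _

  snake     : Bool → ∀ c cs → Linked Eb (c ∷ cs) → List Block
  snakeTail : Bool → ∀ c cs → Linked Eb (c ∷ cs) → List Block
  snake o c cs p = oriented o c ∷ snakeTail o c cs p
  snakeTail o c []       [-]     = []
  snakeTail o c (d ∷ ds) (e ∷ p) = snake (next o (classify e)) d ds p

  final : Bool → ∀ c cs → Linked Eb (c ∷ cs) → Bool
  final o c []       [-]     = o
  final o c (d ∷ ds) (e ∷ p) = final (next o (classify e)) d ds p

  snake-joined : ∀ o c cs (p : Linked Eb (c ∷ cs)) b → Joined (oriented (final o c cs p) (lastOf c cs)) b →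
                 Linked Joined (snake o c cs p ++ [ b ])
  snake-joined o c []       [-]     b j = j ∷ [-]
  snake-joined o c (d ∷ ds) (e ∷ p) b j = next-joined o c d e ∷ snake-joined _ d ds p b j

  snake-bases : ∀ o c cs p → map base (snake o c cs p) ≡ c ∷ cs
  snake-bases o c []       [-]     = refl
  snake-bases o c (d ∷ ds) (e ∷ p) = cong (c ∷_) (snake-bases _ d ds p)

  snake-unique : ∀ o c cs p → All UniqueBlock (snake o c cs p)
  snake-unique o c []       [-]     = oriented-unique o c ∷ []
  snake-unique o c (d ∷ ds) (e ∷ p) = oriented-unique o c ∷ snake-unique _ d ds p

  snake-inside : ∀ o c cs p → All Pb (c ∷ cs) → All BlockInside (snake o c cs p)
  snake-inside o c []       [-]     (pc ∷ [])  = (pc , oriented-∈⁻ o c) ∷ []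
  snake-inside o c (d ∷ ds) (e ∷ p) (pc ∷ ps) = (pc , oriented-∈⁻ o c) ∷ snake-inside _ d ds p ps

  snake-∈ : ∀ o c cs p {c′} → c′ ∈ c ∷ cs → ∃ λ o′ → oriented o′ c′ ∈ snake o c cs p
  snake-∈ o c cs       p       (here refl) = o , here refl
  snake-∈ o c (d ∷ ds) (e ∷ p) (there c′∈) with snake-∈ _ d ds p c′∈
  ... | o′ , b∈ = o′ , there b∈

  snake⇒tour : ∀ o x xs (p : Linked Eb (x ∷ xs)) → All Pb (x ∷ xs) → Unique (x ∷ xs) →
               (∀ c → Pb c → c ∈ x ∷ xs) → 2 ≤ length (x ∷ xs) →
               Joined (oriented (final o x xs p) (lastOf x xs)) (oriented o x) → Tour Total E
  snake⇒tour o x xs p ins u cov len closing =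
    chain⇒tour (oriented o x) (snakeTail o x xs p) (snake-joined o x xs p _ closing)
      (snake-unique o x xs p) (snake-inside o x xs p ins)
      (flatten-unique (snake o x xs p) (subst Unique (sym (snake-bases o x xs p)) u) (snake-unique o x xs p))
      covers
      (subst (2 ≤_) (trans (cong length (sym (snake-bases o x xs p))) (length-map base (snake o x xs p))) len)
    where
    covers : ∀ c a → Pb c → a ∈ fibre c → (c , a) ∈ flatten (snake o x xs p)
    covers c a pc a∈ with snake-∈ o x xs p (cov c pc)
    ... | o′ , b∈ = ∈-flatten⁺ (snake o x xs p) b∈ (oriented-∈⁺ o′ c a∈)

  final-fixed-or-rigid : ∀ c cs p → (∀ o o′ → final o c cs p ≡ final o′ c cs p) ⊎ Linked Rigid (c ∷ cs)
  final-fixed-or-rigid c []       [-]     = inj₂ [-]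
  final-fixed-or-rigid c (d ∷ ds) (e ∷ p) with classify e
  ... | inj₂ _ = inj₁ λ o o′ → refl
  ... | inj₁ rigid with final-fixed-or-rigid d ds p
  ...   | inj₁ fixed  = inj₁ λ o o′ → fixed (not o) (not o′)
  ...   | inj₂ rigids = inj₂ (rigid ∷ rigids)

  rigid-fibres : ∀ c cs → Linked Rigid (c ∷ cs) → All (λ d → hd d ≡ hd c × tl d ≡ tl c) (c ∷ cs)
  rigid-fibres c []       [-]                      = (refl , refl) ∷ []
  rigid-fibres c (d ∷ ds) ((hd≡ , tl≡ , _) ∷ rigids) =
    (refl , refl) ∷ All.map (λ (h′ , t′) → trans h′ (sym hd≡) , trans t′ (sym tl≡)) (rigid-fibres d ds rigids)

  -- Prism tours, for a base tour all of whose edges are rigid, with common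
  -- fibre h ∷ R where R = r ∷ rs is nonempty: go out through the pairs (c , h)
  -- and come back through the blocks R over each c, alternately reversed.
  module Prism (h r : C) (rs : List C) (fibre-unique′ : Unique (h ∷ r ∷ rs)) where

    h∉R : h ∉ r ∷ rs
    h∉R p = All.lookup (AllPairs.head fibre-unique′) p refl

    R-unique : Unique (r ∷ rs)
    R-unique = AllPairs.tail fibre-unique′

    SameFibre : B → Set
    SameFibre c = hd c ≡ h × tl c ≡ r ∷ rs

    returnRun : Bool → C × List C
    returnRun false = r , rs
    returnRun true  = reverse⁺ r rs

    returnRun-∈⁻ : ∀ o {a} → a ∈ cons (returnRun o) → a ∈ r ∷ rs
    returnRun-∈⁻ false p = p
    returnRun-∈⁻ true  p = reverse⁺-∈⁻ r rs p

    returnRun-∈⁺ : ∀ o {a} → a ∈ r ∷ rs → a ∈ cons (returnRun o)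
    returnRun-∈⁺ false p = p
    returnRun-∈⁺ true  p = reverse⁺-∈⁺ r rs p

    returnRun-unique : ∀ o → Unique (cons (returnRun o))
    returnRun-unique false = R-unique
    returnRun-unique true  = reverse⁺-unique r rs R-unique

    outward : B → Block
    outward c = block c h []

    back : B → Bool → Block
    back c o = block c (proj₁ (returnRun o)) (proj₂ (returnRun o))

    prism : B → List B → Bool → List Block
    inner : B → List B → Bool → List Block
    prism c cs o = outward c ∷ inner c cs o ++ [ back c o ]
    inner c []       o = []
    inner c (d ∷ ds) o = prism d ds (not o)

    prism-last : ∀ c cs o → lastOf (outward c) (inner c cs o ++ [ back c o ]) ≡ back c o
    prism-last c []       o = refl
    prism-last c (d ∷ ds) o = lastOf-snoc (outward d) (inner d ds (not o) ++ [ back d (not o) ]) (back c o)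

    back-joined : ∀ c d o → (∀ a → E (c , a) (d , a)) → Joined (back d (not o)) (back c o)
    back-joined c d false same = E-resp (sym (reverse⁺-last r rs)) refl (E-sym (same r))
    back-joined c d true  same = E-resp refl (sym (reverse⁺-head r rs)) (E-sym (same (lastOf r rs)))

    turn-joined : ∀ c o → Joined (outward c) (back c o)
    turn-joined c o = vertical c h _ λ h≡ → h∉R (subst (_∈ r ∷ rs) (sym h≡) (returnRun-∈⁻ o (here refl)))

    prism-joined : ∀ c cs o → Linked Rigid (c ∷ cs) → Linked Joined (prism c cs o)
    prism-joined c []       o [-]                     = turn-joined c o ∷ [-]
    prism-joined c (d ∷ ds) o ((_ , _ , same) ∷ rigids) =
      same h ∷ linked-++ (outward d) (inner d ds (not o) ++ [ back d (not o) ]) (back c o) []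
        (prism-joined d ds (not o) rigids)
        (subst (λ b → Joined b (back c o)) (sym (prism-last d ds (not o))) (back-joined c d o same))
        [-]

    prism-bases : ∀ c cs o → All (λ b → base b ∈ c ∷ cs) (prism c cs o)
    inner-bases : ∀ c cs o → All (λ b → base b ∈ cs) (inner c cs o)
    prism-bases c cs o = here refl ∷ All.++⁺ (All.map there (inner-bases c cs o)) (here refl ∷ [])
    inner-bases c []       o = []
    inner-bases c (d ∷ ds) o = prism-bases d ds (not o)

    prism-unique-blocks : ∀ c cs o → All UniqueBlock (prism c cs o)
    inner-unique-blocks : ∀ c cs o → All UniqueBlock (inner c cs o)
    prism-unique-blocks c cs o = ([] ∷ []) ∷ All.++⁺ (inner-unique-blocks c cs o) (returnRun-unique o ∷ [])
    inner-unique-blocks c []       o = []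
    inner-unique-blocks c (d ∷ ds) o = prism-unique-blocks d ds (not o)

    OutOrBack : Block → Set
    OutOrBack b = ∀ {a} → a ∈ colours b → a ≡ h ⊎ a ∈ r ∷ rs

    prism-colours : ∀ c cs o → All OutOrBack (prism c cs o)
    inner-colours : ∀ c cs o → All OutOrBack (inner c cs o)
    prism-colours c cs o =
      (λ { (here refl) → inj₁ refl }) ∷ All.++⁺ (inner-colours c cs o) ((λ a∈ → inj₂ (returnRun-∈⁻ o a∈)) ∷ [])
    inner-colours c []       o = []
    inner-colours c (d ∷ ds) o = prism-colours d ds (not o)

    prism-inside : ∀ c cs o → All Pb (c ∷ cs) → All SameFibre (c ∷ cs) → All BlockInside (prism c cs o)
    prism-inside c cs o ps fibres = 
      All.zipWith inside (prism-bases c cs o , prism-colours c cs o)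
      where
      inside : ∀ {b} → base b ∈ c ∷ cs × OutOrBack b → BlockInside b
      inside {b} (b∈ , kind) with All.lookup fibres b∈
      ... | hd≡ , tl≡ = All.lookup ps b∈ , λ a∈ → in-fibre (kind a∈)
        where
        in-fibre : ∀ {a} → a ≡ h ⊎ a ∈ r ∷ rs → a ∈ fibre (base b)
        in-fibre (inj₁ refl) = here (sym hd≡)
        in-fibre (inj₂ a∈R)  = there (subst (_ ∈_) (sym tl≡) a∈R)

    prism-∈ : ∀ c cs o {c′} → c′ ∈ c ∷ cs → outward c′ ∈ prism c cs o × ∃ λ o′ → back c′ o′ ∈ prism c cs o
    prism-∈ c cs       o (here refl) = here refl , o , there (∈-++⁺ʳ (inner c cs o) (here refl))
    prism-∈ c (d ∷ ds) o (there c′∈) with prism-∈ d ds (not o) c′∈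
    ... | out∈ , o′ , back∈ = there (∈-++⁺ˡ out∈) , o′ , there (∈-++⁺ˡ back∈)

    prism-unique : ∀ c cs o → Unique (c ∷ cs) → Unique (flatten (prism c cs o))
    inner-unique : ∀ c cs o → Unique (c ∷ cs) → Unique (flatten (inner c cs o))
    inner-unique c []       o _       = []
    inner-unique c (d ∷ ds) o (_ ∷ u) = prism-unique d ds (not o) u
    prism-unique c cs o u@(c∉ ∷ _) =
      All.tabulate (λ q∈ q≡ → start-new (subst (_∈ flatten (inner c cs o ++ [ back c o ])) (sym q≡) q∈)) ∷
      subst Unique (sym (flatten-++ (inner c cs o) [ back c o ]))
        (Unique.++⁺ (inner-unique c cs o u) (flatten-unique [ back c o ] ([] ∷ []) (returnRun-unique o ∷ []))
          λ (p , q) → c∉cs (subst (_∈ cs) (over-c q) (in-cs p)))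
      where
      c∉cs : c ∉ cs
      c∉cs p = All.lookup c∉ p refl
      in-cs : ∀ {q} → q ∈ flatten (inner c cs o) → proj₁ q ∈ cs
      in-cs = flatten-bases (inner c cs o) (inner-bases c cs o)
      over-c : ∀ {q} → q ∈ flatten [ back c o ] → proj₁ q ≡ c
      over-c q∈ with flatten-bases {L = [ c ]} [ back c o ] (here refl ∷ []) q∈
      ... | here e = e
      ... | there ()
      start-new : (c , h) ∉ flatten (inner c cs o ++ [ back c o ])
      start-new p with ∈-++⁻ (flatten (inner c cs o)) (subst ((c , h) ∈_) (flatten-++ (inner c cs o) [ back c o ]) p)
      ... | inj₁ p′ = c∉cs (in-cs p′)
      ... | inj₂ p′ with ∈-flatten⁻ [ back c o ] p′
      ...   | here (_ , h∈) = h∉R (returnRun-∈⁻ o h∈)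

    prism⇒tour : ∀ x xs → Linked Rigid (x ∷ xs) → All Pb (x ∷ xs) → Unique (x ∷ xs) →
                 (∀ c → Pb c → c ∈ x ∷ xs) → All SameFibre (x ∷ xs) → Tour Total E
    prism⇒tour x xs rigids ps u cov fibres =
      chain⇒tour (outward x) (inner x xs false ++ [ back x false ]) closed
        (prism-unique-blocks x xs false) (prism-inside x xs false ps fibres) (prism-unique x xs false u) covers
        (s≤s (≤-trans (m≤n+m 1 (length (inner x xs false))) (≤-reflexive (sym (length-++ (inner x xs false))))))
      where
      closed : Linked Joined (prism x xs false ++ [ outward x ])
      closed = linked-++ (outward x) (inner x xs false ++ [ back x false ]) (outward x) []
        (prism-joined x xs false rigids)
        (subst (λ b → Joined b (outward x)) (sym (prism-last x xs false))
          (vertical x (lastOf r rs) h λ e → h∉R (subst (_∈ r ∷ rs) e (lastOf-∈ r rs))))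
        [-]
      covers : ∀ c a → Pb c → a ∈ fibre c → (c , a) ∈ flatten (prism x xs false)
      covers c a pc a∈ with All.lookup fibres (cov c pc) | prism-∈ x xs false (cov c pc)
      ... | hd≡ , tl≡ | out∈ , o′ , back∈ with a∈
      ...   | here refl = ∈-flatten⁺ (prism x xs false) out∈ (here hd≡)
      ...   | there a∈tl = ∈-flatten⁺ (prism x xs false) back∈ (returnRun-∈⁺ o′ (subst (a ∈_) tl≡ a∈tl))

  rigid-joined-single : ∀ o c d → Rigid c d → tl d ≡ [] → Joined (oriented o c) (oriented false d)
  rigid-joined-single true  c d rigid                 _     = rigid-joined true c d rigid
  rigid-joined-single false c d (hd≡ , tl≡ , same) tl≡[] =
    E-resp (cong (lastOf (hd c)) (sym (trans tl≡ tl≡[]))) hd≡ (same (hd c))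

  lift : Tour Pb Eb → Tour Total E
  lift (tour x xs ps u cov len closed) with linked-unsnoc x xs x closed
  ... | p , last~x = by-closing-edge (classify last~x)
    where
    by-closing-edge : Rigid (lastOf x xs) x ⊎ Flexible (lastOf x xs) x → Tour Total E
    all-rigid       : Linked Rigid (x ∷ xs) → Rigid (lastOf x xs) x → ∀ t → tl x ≡ t → Tour Total E

    by-closing-edge (inj₂ flexible) = snake⇒tour false x xs p ps u cov len (flexible _ _)
    by-closing-edge (inj₁ rigid) with final-fixed-or-rigid x xs p
    ... | inj₁ fixed  = snake⇒tour o x xs p ps u cov len
            (subst (λ o′ → Joined (oriented o′ (lastOf x xs)) (oriented o x)) (fixed false o)
              (rigid-joined (final false x xs p) (lastOf x xs) x rigid))
      where
      o : Bool
      o = not (final false x xs p)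
    ... | inj₂ rigids = all-rigid rigids rigid (tl x) refl

    all-rigid rigids rigid []       tl≡ =
      snake⇒tour false x xs p ps u cov len (rigid-joined-single (final false x xs p) (lastOf x xs) x rigid tl≡)
    all-rigid rigids rigid (r ∷ rs) tl≡ =
      Prism.prism⇒tour (hd x) r rs (subst (λ t → Unique (hd x ∷ t)) tl≡ (fibre-unique x)) x xs rigids ps u cov
        (All.map (λ (hd≡ , tl≡′) → hd≡ , trans tl≡′ tl≡) (rigid-fibres x xs rigids))

size-insert-false : ∀ {n} (S : Subset n) (i : Fin (suc n)) → ∣ insertAt S i false ∣ ≡ ∣ S ∣
size-insert-false S           fzero    = refl
size-insert-false (true ∷ S)  (fsuc i) = cong suc (size-insert-false S i)
size-insert-false (false ∷ S) (fsuc i) = size-insert-false S i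

size-insert-true : ∀ {n} (S : Subset n) (i : Fin (suc n)) → ∣ insertAt S i true ∣ ≡ suc ∣ S ∣
size-insert-true S           fzero    = refl
size-insert-true (true ∷ S)  (fsuc i) = cong suc (size-insert-true S i)
size-insert-true (false ∷ S) (fsuc i) = size-insert-true S i

walk-++ : ∀ {n} {G : Graph n} {S x y z} → WalkIn G S x y → WalkIn G S y z → WalkIn G S x z
walk-++ (here _)      w = w
walk-++ (step p a w₁) w = step p a (walk-++ w₁ w)

nonempty : (xs : List A) {a : A} → a ∈ xs → Σ A λ y → Σ (List A) λ ys → xs ≡ y ∷ ys
nonempty (y ∷ ys) _ = y , ys , refl

true≢false : true ≢ false
true≢false ()

module Extension {n} (k : ℕ) (H : Graph (suc n)) (v : Fin (suc n)) where

  H′ : Graph n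
  H′ = delete H v

  extend : Coloring k n → Fin k → Coloring k (suc n)
  extend c a = insertAt c v a

  extend-v : ∀ c a → lookup (extend c a) v ≡ a
  extend-v c a = Vec.insertAt-lookup c v a

  extend-other : ∀ c a y → lookup (extend c a) (punchIn v y) ≡ lookup c y
  extend-other c a y = Vec.insertAt-punchIn c v a y

  extend-injective : ∀ {c d a b} → extend c a ≡ extend d b → c ≡ d × a ≡ b
  extend-injective {c} {d} {a} {b} e =
    trans (sym (Vec.removeAt-insertAt c v a)) (trans (cong (λ u → removeAt u v) e) (Vec.removeAt-insertAt d v b)) ,
    trans (sym (extend-v c a)) (trans (cong (λ u → lookup u v) e) (extend-v d b))

  data View (x : Fin (suc n)) : Set where
    is-v    : x ≡ v → View x
    is-other : ∀ y → x ≡ punchIn v y → View x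

  view : ∀ x → View x
  view x with v ≟ᶠ x
  ... | yes v≡x = is-v (sym v≡x)
  ... | no v≢x  = is-other (punchOut v≢x) (sym (punchIn-punchOut v≢x))

  Allowed : Coloring k n → Fin k → Set
  Allowed c a = ∀ y → adj H v (punchIn v y) ≡ true → lookup c y ≢ a

  allowed? : ∀ c → Decidable (Allowed c)
  allowed? c a = all? λ y → (adj H v (punchIn v y) Bool.≟ true) →-dec ¬? (lookup c y ≟ᶠ a)

  proper-extend⁺ : ∀ c a → Proper H′ c → Allowed c a → Proper H (extend c a)
  proper-extend⁺ c a pc al x y e with view x | view y
  ... | is-v refl     | is-v refl     = λ _ → true≢false (trans (sym e) (irrefl H v))
  ... | is-v refl     | is-other y′ refl = λ q → al y′ e (sym (trans (sym (extend-v c a)) (trans q (extend-other c a y′))))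
  ... | is-other x′ refl | is-v refl     =
    λ q → al x′ (trans (Graph.sym H v (punchIn v x′)) e) (trans (sym (extend-other c a x′)) (trans q (extend-v c a)))
  ... | is-other x′ refl | is-other y′ refl =
    λ q → pc x′ y′ e (trans (sym (extend-other c a x′)) (trans q (extend-other c a y′)))

  proper-extend⁻ : ∀ c a → Proper H (extend c a) → Proper H′ c × Allowed c a
  proper-extend⁻ c a pr =
    (λ x y e q → pr (punchIn v x) (punchIn v y) e (trans (extend-other c a x) (trans q (sym (extend-other c a y))))) ,
    (λ y e q → pr v (punchIn v y) e (trans (extend-v c a) (trans (sym q) (sym (extend-other c a y)))))

  allowedColours : Coloring k n → List (Fin k)
  allowedColours c = filter (allowed? c) (allFin k)

  allowedColours-∈⁺ : ∀ c a → Allowed c a → a ∈ allowedColours c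
  allowedColours-∈⁺ c a al = ∈-filter⁺ (allowed? c) (∈-allFin a) al

  allowedColours-∈⁻ : ∀ c a → a ∈ allowedColours c → Allowed c a
  allowedColours-∈⁻ c a p = proj₂ (∈-filter⁻ (allowed? c) {xs = allFin k} p)

  allowedColours-unique : ∀ c → Unique (allowedColours c)
  allowedColours-unique c = Unique.filter⁺ (allowed? c) (Unique.allFin⁺ k)

  -- If d_H(v) < k then some colour is allowed: otherwise every colour would
  -- occur on one of the fewer than k neighbours of v.
  allowed-exists : degree H v < k → ∀ c → ∃ (Allowed c)
  allowed-exists deg c with any? (allowed? c)
  ... | yes found = found
  ... | no none = ⊥-elim (<⇒≱ deg (begin
      k                             ≡⟨ sym (length-tabulate _) ⟩
      length (allFin k)             ≤⟨ unique-length-≤ (allFin k) (map colour neighbours) (Unique.allFin⁺ k) used ⟩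
      length (map colour neighbours) ≡⟨ length-map colour neighbours ⟩
      degree H v                    ∎))
    where
    open ≤-Reasoning
    neighbours : List (Fin (suc n))
    neighbours = filterᵇ (adj H v) (allFin (suc n))
    colour : Fin (suc n) → Fin k
    colour = lookup (extend c (fromℕ< (≤-<-trans z≤n deg)))
    used : ∀ {a} → a ∈ allFin k → a ∈ map colour neighbours
    used {a} _ with ¬∀⟶∃¬ n _ (λ y → (adj H v (punchIn v y) Bool.≟ true) →-dec ¬? (lookup c y ≟ᶠ a)) (λ al → none (a , al))
    ... | y , ¬al with adj H v (punchIn v y) Bool.≟ true | lookup c y ≟ᶠ a
    ...   | no ¬e  | _      = ⊥-elim (¬al (λ e → ⊥-elim (¬e e)))
    ...   | yes _  | no c≢a = ⊥-elim (¬al (λ _ → c≢a))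
    ...   | yes e  | yes c≡a = subst (_∈ map colour neighbours) (trans (extend-other c _ y) c≡a)
      (∈-map⁺ colour (∈-filter⁺ (λ x → T? (adj H v x)) (∈-allFin (punchIn v y)) (subst T (sym e) tt)))

  liftSubset : Subset n → Bool → Subset (suc n)
  liftSubset S b = insertAt S v b

  ∈-lift⁺ : ∀ S b y → y ∈ₛ S → punchIn v y ∈ₛ liftSubset S b
  ∈-lift⁺ S b y p = Vec.lookup⇒[]= _ _ (trans (Vec.insertAt-punchIn S v b y) (Vec.[]=⇒lookup p))

  ∈-lift⁻ : ∀ S b y → punchIn v y ∈ₛ liftSubset S b → y ∈ₛ S
  ∈-lift⁻ S b y p = Vec.lookup⇒[]= _ _ (trans (sym (Vec.insertAt-punchIn S v b y)) (Vec.[]=⇒lookup p))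

  v∈lift : ∀ S → v ∈ₛ liftSubset S true
  v∈lift S = Vec.lookup⇒[]= _ _ (Vec.insertAt-lookup S v true)

  v∉lift : ∀ S → ¬ (v ∈ₛ liftSubset S false)
  v∉lift S p = true≢false (trans (sym (Vec.[]=⇒lookup p)) (Vec.insertAt-lookup S v false))

  lift-walk : ∀ {S T x y} → (∀ z → z ∈ₛ S → punchIn v z ∈ₛ T) → WalkIn H′ S x y →
              WalkIn H T (punchIn v x) (punchIn v y)
  lift-walk inT (here p)     = here (inT _ p)
  lift-walk inT (step p a w) = step (inT _ p) a (lift-walk inT w)

  module Steps (m : ℕ) where

    Step : Coloring k (suc n) → Coloring k (suc n) → Set
    Step = ReconfAdj H (suc m)

    step-sym : ∀ {u w} → Step u w → Step w u
    step-sym (u≢w , S , size , diff , conn) = (λ e → u≢w (sym e)) , S , size , (λ x d → diff x (λ e → d (sym e))) , conn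

    vertical-step : ∀ c a b → a ≢ b → Step (extend c a) (extend c b)
    vertical-step c a b a≢b =
      (λ e → a≢b (proj₂ (extend-injective e))) , ⁅ v ⁆ , subst (_≤ suc m) (sym (∣⁅x⁆∣≡1 v)) (s≤s z≤n) , diff , conn
      where
      diff : ∀ x → lookup (extend c a) x ≢ lookup (extend c b) x → x ∈ₛ ⁅ v ⁆
      diff x d with view x
      ... | is-v refl       = x∈⁅x⁆ v
      ... | is-other y refl = ⊥-elim (d (trans (extend-other c a y) (sym (extend-other c b y))))
      conn : ConnectedIn H ⁅ v ⁆
      conn x y x∈ y∈ with x∈⁅y⁆⇒x≡y v x∈ | x∈⁅y⁆⇒x≡y v y∈
      ... | refl | refl = here x∈

    rigid-step : ∀ {c d} → ReconfAdj H′ m c d → ∀ a → Step (extend c a) (extend d a)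
    rigid-step {c} {d} (c≢d , S , size , diff , conn) a =
      (λ e → c≢d (proj₁ (extend-injective e))) , liftSubset S false ,
      subst (_≤ suc m) (sym (size-insert-false S v)) (m≤n⇒m≤1+n size) , diff′ , conn′
      where
      diff′ : ∀ x → lookup (extend c a) x ≢ lookup (extend d a) x → x ∈ₛ liftSubset S false
      diff′ x d′ with view x
      ... | is-v refl       = ⊥-elim (d′ (trans (extend-v c a) (sym (extend-v d a))))
      ... | is-other y refl = ∈-lift⁺ S false y (diff y λ e → d′ (trans (extend-other c a y) (trans e (sym (extend-other d a y)))))
      conn′ : ConnectedIn H (liftSubset S false)
      conn′ x y x∈ y∈ with view x | view y
      ... | is-v refl        | _                = ⊥-elim (v∉lift S x∈)
      ... | is-other _ _     | is-v refl        = ⊥-elim (v∉lift S y∈)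
      ... | is-other x′ refl | is-other y′ refl =
        lift-walk (∈-lift⁺ S false) (conn x′ y′ (∈-lift⁻ S false x′ x∈) (∈-lift⁻ S false y′ y∈))

    flexible-step : ∀ {c d} (r : ReconfAdj H′ m c d) w → w ∈ₛ proj₁ (proj₂ r) → adj H v (punchIn v w) ≡ true →
                    ∀ a b → Step (extend c a) (extend d b)
    flexible-step {c} {d} (c≢d , S , size , diff , conn) w w∈ v~w a b =
      (λ e → c≢d (proj₁ (extend-injective e))) , S⁺ ,
      subst (_≤ suc m) (sym (size-insert-true S v)) (s≤s size) , diff′ , λ x y x∈ y∈ → walk-++ (to-v x x∈) (from-v y y∈)
      where
      S⁺ : Subset (suc n)
      S⁺ = liftSubset S true
      diff′ : ∀ x → lookup (extend c a) x ≢ lookup (extend d b) x → x ∈ₛ S⁺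
      diff′ x d′ with view x
      ... | is-v refl       = v∈lift S
      ... | is-other y refl = ∈-lift⁺ S true y (diff y λ e → d′ (trans (extend-other c a y) (trans e (sym (extend-other d b y)))))
      to-v : ∀ x → x ∈ₛ S⁺ → WalkIn H S⁺ x v
      to-v x x∈ with view x
      ... | is-v refl        = here x∈
      ... | is-other x′ refl = walk-++ (lift-walk (∈-lift⁺ S true) (conn x′ w (∈-lift⁻ S true x′ x∈) w∈))
        (step (∈-lift⁺ S true w w∈) (trans (Graph.sym H (punchIn v w) v) v~w) (here (v∈lift S)))
      from-v : ∀ y → y ∈ₛ S⁺ → WalkIn H S⁺ v y
      from-v y y∈ with view y
      ... | is-v refl        = here y∈
      ... | is-other y′ refl = step (v∈lift S) v~w (lift-walk (∈-lift⁺ S true) (conn w y′ w∈ (∈-lift⁻ S true y′ y∈)))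

  module Fibres (deg : degree H v < k) where

    split : ∀ c → Σ (Fin k) λ a → Σ (List (Fin k)) λ as → allowedColours c ≡ a ∷ as
    split c = nonempty (allowedColours c) (allowedColours-∈⁺ c _ (proj₂ (allowed-exists deg c)))

    fibreHead : Coloring k n → Fin k
    fibreHead c = proj₁ (split c)

    fibreTail : Coloring k n → List (Fin k)
    fibreTail c = proj₁ (proj₂ (split c))

    fibre-≡ : ∀ c → allowedColours c ≡ fibreHead c ∷ fibreTail c
    fibre-≡ c = proj₂ (proj₂ (split c))

    fibre-unique : ∀ c → Unique (fibreHead c ∷ fibreTail c)
    fibre-unique c = subst Unique (fibre-≡ c) (allowedColours-unique c)

    proper-fibre : ∀ c a → Proper H′ c → a ∈ fibreHead c ∷ fibreTail c → Proper H (extend c a)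
    proper-fibre c a pc a∈ = proper-extend⁺ c a pc (allowedColours-∈⁻ c a (subst (a ∈_) (sym (fibre-≡ c)) a∈))

    proper-split : ∀ u → Proper H u → ∃ λ c → ∃ λ a → (Proper H′ c × a ∈ fibreHead c ∷ fibreTail c) × u ≡ extend c a
    proper-split u pu =
      removeAt u v , lookup u v , (proj₁ parts , subst (lookup u v ∈_) (fibre-≡ (removeAt u v)) (allowedColours-∈⁺ (removeAt u v) (lookup u v) (proj₂ parts))) , u≡
      where
      u≡ : u ≡ extend (removeAt u v) (lookup u v)
      u≡ = sym (Vec.insertAt-removeAt u v)
      parts : Proper H′ (removeAt u v) × Allowed (removeAt u v) (lookup u v)
      parts = proper-extend⁻ (removeAt u v) (lookup u v) (subst (Proper H) u≡ pu)

    module Lifted (m : ℕ) where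
      open Steps m

      -- An edge of G^m_k(H - v) is flexible if its witness meets N(v); otherwise
      -- its ends agree on N(v), hence have the same fibre, and it is rigid.
      classify : ∀ {c d} → ReconfAdj H′ m c d →
        (fibreHead c ≡ fibreHead d × fibreTail c ≡ fibreTail d × (∀ a → Step (extend c a) (extend d a))) ⊎
        (∀ a b → Step (extend c a) (extend d b))
      classify {c} {d} r@(_ , S , _ , diff , _)
        with any? (λ w → (w ∈ₛ? S) ×-dec (adj H v (punchIn v w) Bool.≟ true))
      ... | yes (w , w∈ , v~w) = inj₂ (flexible-step r w w∈ v~w)
      ... | no misses = inj₁ (proj₁ same-fibre , proj₂ same-fibre , rigid-step r)
        where
        agree : ∀ y → adj H v (punchIn v y) ≡ true → lookup c y ≡ lookup d y
        agree y v~y with lookup c y ≟ᶠ lookup d y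
        ... | yes e = e
        ... | no ne = ⊥-elim (misses (y , diff y ne , v~y))
        same-allowed : allowedColours c ≡ allowedColours d
        same-allowed = filter-≐ (allowed? c) (allowed? d)
          ((λ al y v~y e → al y v~y (trans (agree y v~y) e)) , (λ al y v~y e → al y v~y (trans (sym (agree y v~y)) e)))
          (allFin k)
        same-fibre : fibreHead c ≡ fibreHead d × fibreTail c ≡ fibreTail d
        same-fibre = ∷-injective (trans (sym (fibre-≡ c)) (trans same-allowed (fibre-≡ d)))

      open FibreLifting (Proper H′) (ReconfAdj H′ m) fibreHead fibreTail fibre-unique
        (λ (c , a) (d , b) → Step (extend c a) (extend d b)) step-sym vertical-step classify
        using (lift)

      lift-tour : Tour (Proper H′) (ReconfAdj H′ m) → Tour (Proper H) Step
      lift-tour t = tour-map (λ (c , a) → extend c a)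
        (λ e → cong₂ _,_ (proj₁ (extend-injective e)) (proj₂ (extend-injective e)))
        (λ { {c , a} (pc , a∈) → proper-fibre c a pc a∈ })
        (λ u pu → let (c , a , ok , u≡) = proper-split u pu in (c , a) , ok , u≡)
        (λ e → e) (lift t)

      single⇒complete : ∀ c → (∀ d → Proper H′ d → d ≡ c) → Complete (Proper H) Step
      single⇒complete c unique u w pu pw u≢w with proper-split u pu | proper-split w pw
      ... | cu , a , (pcu , _) , refl | cw , b , (pcw , _) , refl with unique cu pcu | unique cw pcw
      ...   | refl | refl = vertical-step c a b (λ a≡b → u≢w (cong (extend c) a≡b))

      -- Hamiltonicity of G^m_k(H - v) gives Hamiltonicity of G^(m+1)_k(H): a
      -- Hamiltonian cycle, or a complete graph on ≥ 2 vertices, is a tour, and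
      -- a complete graph on one vertex lifts to a complete graph.
      hamiltonian-lift : ChromaticAtMost k H′ → GHam k m H′ → GHam k (suc m) H
      hamiltonian-lift _ (inj₂ cycle) = tour⇒hamiltonian (lift-tour (hamCycle⇒tour cycle))
      hamiltonian-lift (c₀ , pc₀) (inj₁ complete) = by-listing (listing (proper? H′))
        where
        by-listing : Σ (List (Coloring k n)) (λ cs → All (Proper H′) cs × Unique cs × (∀ c → Proper H′ c → c ∈ cs)) →
                     GHam k (suc m) H
        by-listing ([] , _ , _ , cov) with cov c₀ pc₀
        ... | ()
        by-listing (x ∷ [] , _ , _ , cov) = inj₁ (single⇒complete x λ d pd → only (cov d pd))
          where
          only : ∀ {d} → d ∈ x ∷ [] → d ≡ x
          only (here e) = e
        by-listing (x ∷ y ∷ ys , ps , u , cov) = tour⇒hamiltonian (lift-tour (complete⇒tour complete x y ys ps u cov))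

mainTheorem19 : ∀ {n} (k : ℕ) → 1 ≤ k → (H : Graph (suc n)) (v : Fin (suc n)) →
    degree H v < k → ChromaticAtMost k (delete H v) →
    ∀ m → IsHk k (delete H v) m → ∃ λ m' → IsHk k H m' × m' ≤ suc m
mainTheorem19 k _ H v deg χ≤k m (_ , hamiltonian , _) =
  least-≤ (λ j → gHam? k j H) m (Lifted.hamiltonian-lift m χ≤k hamiltonian)
  where
  open Extension k H v
  open Fibres deg
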